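{- Let $k\geq 2$ be an integer and let $Q=T[H_1,\dots,H_t]$ be a digraph composition, where $T$ has vertices $u_1,\dots,u_t$ ($t\ge 2$). Then: (a) $Q$ has a $k$-king if and only if there is $i\in[t]$ such that $u_i$ is a $k$-king of $T$ and at least one of the following holds: (i) $H_i$ has a $k$-king; (ii) $|V(H_i)|\geq 2$ and $u_i$ belongs to a (directed) cycle of $T$ of length at most $k$. (b) All vertices of $Q$ are $k$-kings of $Q$ if and only if for each $i\in[t]$, $u_i$ is a $k$-king of $T$ and at least one of the following holds: (i) all vertices of $H_i$ are $k$-kings of $H_i$; (ii) $|V(H_i)|\geq 2$ and $u_i$ belongs to a (directed) cycle of $T$ of length at most $k$.
   Context: All digraphs are finite, without loops or parallel arcs; paths and cycles are directed. For a digraph $D$ and vertices $x,y$, $d_D(x,y)$ is the length of a shortest directed $x$–$y$ path (infinite if none exists). Let $T$ be a digraph with vertices $u_1,\dots,u_t$ ($t\ge 2$) and let $H_1,\dots,H_t$ be digraphs, $H_i$ having vertices $u_{i,j}$, $1\le j\le n_i$. The composition $Q=T[H_1,\dots,H_t]$ is the digraph with vertex set $\{u_{i,j}: 1\le i\le t,1\le j\le n_i\}$ and arc set $\bigcup_{i=1}^t A(H_i)\cup\{u_{i,j}u_{p,q}: u_iu_p\in A(T), 1\le j\le n_i, 1\le q\le n_p\}$. For an integer $k\ge 2$, a $k$-king of a digraph $D$ is a vertex from which every other vertex of $D$ can be reached by a directed path of length at most $k$. -}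

module Defs where

open import Data.Nat using (ℕ; zero; suc; _≤_)
open import Data.Fin using (Fin; zero; suc; fromℕ; inject₁)
open import Data.Bool using (Bool; false; T)
open import Data.Product using (Σ; ∃; ∃-syntax; _×_; _,_)
open import Data.Sum using (_⊎_)
open import Relation.Binary.PropositionalEquality using (_≡_; _≢_)
open import Function.Definitions using (Injective)

record Digraph (n : ℕ) : Set where
  field
    arc      : Fin n → Fin n → Bool
    loopless : ∀ v → arc v v ≡ false
open Digraph public

Arc : ∀ {n} → Digraph n → Fin n → Fin n → Set
Arc D x y = T (arc D x y)

module _ {V : Set} (R : V → V → Set) where

  Path : V → V → ℕ → Set
  Path x y ℓ = Σ (Fin (suc ℓ) → V) λ p →
      p zero ≡ x × p (fromℕ ℓ) ≡ y × Injective _≡_ _≡_ p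
    × (∀ (i : Fin ℓ) → R (p (inject₁ i)) (p (suc i)))

  OnCycle : V → ℕ → Set
  OnCycle u ℓ = Σ ℕ λ m → ℓ ≡ suc m × 1 ≤ m × Σ (Fin (suc m) → V) λ p →
      Injective _≡_ _≡_ p
    × (∀ (i : Fin m) → R (p (inject₁ i)) (p (suc i)))
    × R (p (fromℕ m)) (p zero)
    × ∃[ j ] p j ≡ u

  OnCycleAtMost : ℕ → V → Set
  OnCycleAtMost k u = ∃[ ℓ ] ℓ ≤ k × OnCycle u ℓ

  IsKing : ℕ → V → Set
  IsKing k x = ∀ y → y ≢ x → ∃[ ℓ ] ℓ ≤ k × Path x y ℓ

  HasKing : ℕ → Set
  HasKing k = ∃[ x ] IsKing k x

  AllKings : ℕ → Set
  AllKings k = ∀ x → IsKing k x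

-- Vertex set of the composition T[H_1,...,H_t]: u_{i,j} ↦ (i , j).
CompV : (t : ℕ) (n : Fin t → ℕ) → Set
CompV t n = Σ (Fin t) λ i → Fin (n i)

CompArc : ∀ {t} {n : Fin t → ℕ} → Digraph t → ((i : Fin t) → Digraph (n i))
        → CompV t n → CompV t n → Set
CompArc {n = n} Tg H (i , j) (p , q) =
  (Σ (i ≡ p) λ { _≡_.refl → Arc (H i) j q }) ⊎ Arc Tg i p

module Submission where

-- Reasoning about distinct-vertex paths directly is awkward, so we
-- work with walks (arc sequences, vertices may repeat) and use two translations:
-- every path is a walk, and every walk can be shortened to a path (loop erasure).
-- A vertex lies on a cycle of length ≤ k iff it has a closed walk of length in
-- [1, k] (the graph being loopless).  In Q = T[H₁,…,Hₜ]:
--  * a T-walk of positive length lifts to a Q-walk of the same length between any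
--    vertices of the end fibres, and an Hᵢ-walk lifts to a Q-walk inside fibre i;
--  * a Q-walk projects to a T-walk that is no longer, and a Q-walk from fibre i
--    back to fibre i either stays inside Hᵢ or yields a closed T-walk at uᵢ.
-- From these, u_{i,j} is a k-king of Q iff uᵢ is a k-king of T and either u_{i,j}
-- is a k-king of Hᵢ or (|V(Hᵢ)| ≥ 2 and uᵢ is on a cycle of length ≤ k)
-- (lemmas kingLift and kingProj).  Both parts of the theorem follow, part (b)
-- using a finite choice principle over the vertices of Hᵢ.

open import Defs
open import Data.Nat using (ℕ; zero; suc; _+_; _≤_; z≤n; s≤s)
open import Data.Nat.Properties using (≤-refl; ≤-trans; m≤n⇒m≤1+n; +-suc; +-comm)
open import Data.Fin using (Fin; zero; suc; fromℕ; inject₁)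
open import Data.Fin.Properties using (any?; _≟_)
open import Data.Product using (Σ; ∃-syntax; _×_; _,_; proj₁; proj₂; map₂)
open import Data.Product.Properties using (≡-dec)
open import Data.Sum using (_⊎_; inj₁; inj₂; map₁) renaming (map to map⊎)
open import Data.Unit using (⊤; tt)
open import Data.Empty using (⊥-elim)
open import Data.Bool using (T)
open import Relation.Nullary using (yes; no; ¬_)
open import Relation.Binary.PropositionalEquality
  using (_≡_; _≢_; refl; sym; trans; cong; subst; subst₂)
open import Relation.Binary.Definitions using (DecidableEquality)
open import Function.Bundles using (_⇔_; mk⇔)

Reach : {V : Set} → (V → V → Set) → ℕ → V → V → Set
Reach R k x y = ∃[ ℓ ] ℓ ≤ k × Path R x y ℓ

arc-irreflexive : ∀ {m} (D : Digraph m) v → ¬ Arc D v v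
arc-irreflexive D v a = subst T (loopless D v) a

distinct⇒2≤ : ∀ {N} (a b : Fin N) → a ≢ b → 2 ≤ N
distinct⇒2≤ {suc zero}    zero zero a≢b = ⊥-elim (a≢b refl)
distinct⇒2≤ {suc (suc N)} _    _    _   = s≤s (s≤s z≤n)

finChoice : ∀ {N} {A : Fin N → Set} {B : Set} → (∀ q → A q ⊎ B) → (∀ q → A q) ⊎ B
finChoice {zero}  f = inj₁ λ ()
finChoice {suc N} {A} f with f zero | finChoice {N} {λ q → A (suc q)} (λ q → f (suc q))
... | inj₂ b  | _        = inj₂ b
... | inj₁ _  | inj₂ b   = inj₂ b
... | inj₁ a₀ | inj₁ as  = inj₁ λ { zero → a₀ ; (suc q) → as q }

module Walks {V : Set} (R : V → V → Set) where

  infixr 5 _∷_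
  infixr 5 _++_

  data Walk : V → V → ℕ → Set where
    []  : ∀ {x} → Walk x x 0
    _∷_ : ∀ {x y z n} → R x y → Walk y z n → Walk x z (suc n)

  _++_ : ∀ {x y z a b} → Walk x y a → Walk y z b → Walk x z (a + b)
  []      ++ w = w
  (e ∷ v) ++ w = e ∷ (v ++ w)

  walk-nonempty : ∀ {x y n} → Walk x y n → x ≢ y → 1 ≤ n
  walk-nonempty []      x≢y = ⊥-elim (x≢y refl)
  walk-nonempty (_ ∷ _) _   = s≤s z≤n

  vertex : ∀ {x y n} → Walk x y n → Fin (suc n) → V
  vertex {x} []      zero    = x
  vertex {x} (_ ∷ _) zero    = x
  vertex     (_ ∷ w) (suc i) = vertex w i

  vertex-first : ∀ {x y n} (w : Walk x y n) → vertex w zero ≡ x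
  vertex-first []      = refl
  vertex-first (_ ∷ _) = refl

  vertex-last : ∀ {x y n} (w : Walk x y n) → vertex w (fromℕ n) ≡ y
  vertex-last []      = refl
  vertex-last (_ ∷ w) = vertex-last w

  vertex-arc : ∀ {x y n} (w : Walk x y n) (i : Fin n) → R (vertex w (inject₁ i)) (vertex w (suc i))
  vertex-arc (_∷_ {x} e w) zero    = subst (R x) (sym (vertex-first w)) e
  vertex-arc (_   ∷ w)     (suc i) = vertex-arc w i

  Distinct : ∀ {x y n} → Walk x y n → Set
  Distinct []          = ⊤
  Distinct {x} (_ ∷ w) = (∀ i → vertex w i ≢ x) × Distinct w

  vertex-injective : ∀ {x y n} (w : Walk x y n) → Distinct w → ∀ {i j} → vertex w i ≡ vertex w j → i ≡ j
  vertex-injective []      _           {zero}  {zero}  _  = refl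
  vertex-injective (_ ∷ _) _           {zero}  {zero}  _  = refl
  vertex-injective (_ ∷ _) (fresh , _) {zero}  {suc j} eq = ⊥-elim (fresh j (sym eq))
  vertex-injective (_ ∷ _) (fresh , _) {suc i} {zero}  eq = ⊥-elim (fresh i eq)
  vertex-injective (_ ∷ w) (_ , d)     {suc i} {suc j} eq = cong suc (vertex-injective w d eq)

  distinct⇒path : ∀ {x y n} (w : Walk x y n) → Distinct w → Path R x y n
  distinct⇒path w d = vertex w , vertex-first w , vertex-last w , vertex-injective w d , vertex-arc w

  sequenceWalk : ∀ {m} (p : Fin (suc m) → V) → (∀ i → R (p (inject₁ i)) (p (suc i)))
               → Walk (p zero) (p (fromℕ m)) m
  sequenceWalk {zero}  p arcs = []
  sequenceWalk {suc m} p arcs = arcs zero ∷ sequenceWalk (λ i → p (suc i)) (λ i → arcs (suc i))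

  sequenceWalk-vertex : ∀ {m} (p : Fin (suc m) → V) arcs i → vertex (sequenceWalk p arcs) i ≡ p i
  sequenceWalk-vertex {zero}  p arcs zero    = refl
  sequenceWalk-vertex {suc m} p arcs zero    = refl
  sequenceWalk-vertex {suc m} p arcs (suc i) =
    sequenceWalk-vertex (λ i → p (suc i)) (λ i → arcs (suc i)) i

  path⇒walk : ∀ {x y ℓ} → Path R x y ℓ → Walk x y ℓ
  path⇒walk (p , p₀ , pₗ , _ , arcs) = subst₂ (λ u v → Walk u v _) p₀ pₗ (sequenceWalk p arcs)

  splitAt : ∀ {x y n} (w : Walk x y n) (i : Fin (suc n))
          → Σ ℕ λ a → Σ ℕ λ b → a + b ≡ n × Walk x (vertex w i) a × Walk (vertex w i) y b
  splitAt []      zero    = 0 , 0 , refl , [] , []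
  splitAt (e ∷ w) zero    = 0 , _ , refl , [] , e ∷ w
  splitAt (e ∷ w) (suc i) with splitAt w i
  ... | a , b , a+b≡n , w₁ , w₂ = suc a , b , cong suc a+b≡n , e ∷ w₁ , w₂

  module _ (_≟V_ : DecidableEquality V) where

    suffix : ∀ {y z n} (w : Walk y z n) → Distinct w → (i : Fin (suc n))
           → ∃[ m ] m ≤ n × Σ (Walk (vertex w i) z m) Distinct
    suffix []      _       zero    = 0 , z≤n , [] , tt
    suffix (e ∷ w) d       zero    = _ , ≤-refl , e ∷ w , d
    suffix (_ ∷ w) (_ , d) (suc i) with suffix w d i
    ... | m , m≤n , w′ , d′ = m , m≤n⇒m≤1+n m≤n , w′ , d′

    shorten : ∀ {x y n} → Walk x y n → ∃[ m ] m ≤ n × Σ (Walk x y m) Distinct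
    shorten [] = 0 , z≤n , [] , tt
    shorten {x} (e ∷ w) with shorten w
    ... | m , m≤n , w′ , d′ with any? (λ i → vertex w′ i ≟V x)
    ... | no x∉w′ = suc m , s≤s m≤n , e ∷ w′ , (λ i eq → x∉w′ (i , eq)) , d′
    ... | yes (i , vᵢ≡x) with suffix w′ d′ i
    ...   | m′ , m′≤m , w″ , d″ =
      m′ , m≤n⇒m≤1+n (≤-trans m′≤m m≤n) , subst (λ v → Σ (Walk v _ m′) Distinct) vᵢ≡x (w″ , d″)

    walk⇒reach : ∀ {x y n k} → Walk x y n → n ≤ k → Reach R k x y
    walk⇒reach w n≤k with shorten w
    ... | m , m≤n , w′ , d = m , ≤-trans m≤n n≤k , distinct⇒path w′ d

    -- In an irreflexive relation, a closed walk of length in [1, k] yields a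
    -- cycle of length ≤ k: erase the loops of the walk after its first arc.
    closed⇒cycle : (∀ v → ¬ R v v) → ∀ {i m k} → Walk i i m → 1 ≤ m → m ≤ k → OnCycleAtMost R k i
    closed⇒cycle irrefl (e ∷ w) _ m≤k with shorten w
    ... | m′ , m′≤ , w′ , d =
      suc m′ , ≤-trans (s≤s m′≤) m≤k ,
      (m′ , refl , walk-nonempty w′ (λ { refl → irrefl _ e }) , vertex w′ , vertex-injective w′ d ,
       vertex-arc w′ , subst₂ R (sym (vertex-last w′)) (sym (vertex-first w′)) e ,
       fromℕ m′ , vertex-last w′)

  -- A cycle of length ℓ through i gives a closed walk of length ℓ at i:
  -- run the cycle from i to its end, close it, and return to i.
  cycle⇒closed : ∀ {i k} → OnCycleAtMost R k i → ∃[ L ] 1 ≤ L × L ≤ k × Walk i i L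
  cycle⇒closed {i} {k} (ℓ , ℓ≤k , (m , ℓ≡1+m , _ , p , _ , arcs , back , j , pⱼ≡i))
    with splitAt (sequenceWalk p arcs) j
  ... | a , b , a+b≡m , w₁ , w₂ =
    b + suc a , subst (1 ≤_) (sym (+-suc b a)) (s≤s z≤n) , subst (_≤ k) (sym length) ℓ≤k ,
    subst (λ v → Walk v v (b + suc a)) start (w₂ ++ back ∷ w₁)
    where
    length : b + suc a ≡ ℓ
    length = trans (+-suc b a) (trans (cong suc (trans (+-comm b a) a+b≡m)) (sym ℓ≡1+m))
    start : vertex (sequenceWalk p arcs) j ≡ i
    start = trans (sequenceWalk-vertex p arcs j) pⱼ≡i

module Composition {t : ℕ} {n : Fin t → ℕ} (Tg : Digraph t) (H : (i : Fin t) → Digraph (n i))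
                   (nonempty : ∀ i → 1 ≤ n i) (k : ℕ) where

  module TW = Walks (Arc Tg)
  module QW = Walks (CompArc Tg H)
  module HW (i : Fin t) = Walks (Arc (H i))

  point : ∀ i → Fin (n i)
  point i with n i | nonempty i
  ... | suc _ | _ = zero

  -- Equality of vertices of Q is decidable, as loop erasure in Q requires.
  _≟Q_ : DecidableEquality (CompV t n)
  _≟Q_ = ≡-dec _≟_ _≟_

  Cycle≤k : Fin t → Set
  Cycle≤k = OnCycleAtMost (Arc Tg) k

  -- Every arc of T joins all vertices of the two fibres, so a nonempty T-walk
  -- lifts to Q between any chosen vertices of its end fibres.
  liftT : ∀ {a b L} → TW.Walk a b L → 1 ≤ L → ∀ jₐ j_b → QW.Walk (a , jₐ) (b , j_b) L
  liftT (e TW.∷ TW.[])           _ jₐ j_b = inj₂ e QW.∷ QW.[]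
  liftT (e TW.∷ w@(_ TW.∷ _))    _ jₐ j_b = inj₂ e QW.∷ liftT w (s≤s z≤n) (point _) j_b

  liftH : ∀ {i j q m} → HW.Walk i j q m → QW.Walk (i , j) (i , q) m
  liftH HW.[]       = QW.[]
  liftH (a HW.∷ w)  = inj₁ (refl , a) QW.∷ liftH w

  project : ∀ {x y m} → QW.Walk x y m → ∃[ m′ ] m′ ≤ m × TW.Walk (proj₁ x) (proj₁ y) m′
  project QW.[] = 0 , z≤n , TW.[]
  project (inj₁ (refl , _) QW.∷ w) with project w
  ... | m′ , m′≤m , w′ = m′ , m≤n⇒m≤1+n m′≤m , w′
  project (inj₂ e QW.∷ w) with project w
  ... | m′ , m′≤m , w′ = suc m′ , s≤s m′≤m , e TW.∷ w′

  fiberWalk : ∀ {i j q m} → QW.Walk (i , j) (i , q) m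
            → (∃[ m′ ] m′ ≤ m × HW.Walk i j q m′) ⊎ (∃[ L ] 1 ≤ L × L ≤ m × TW.Walk i i L)
  fiberWalk QW.[] = inj₁ (0 , z≤n , HW.[])
  fiberWalk (inj₁ (refl , a) QW.∷ w) with fiberWalk w
  ... | inj₁ (m′ , m′≤m , h)       = inj₁ (suc m′ , s≤s m′≤m , a HW.∷ h)
  ... | inj₂ (L , 1≤L , L≤m , c)   = inj₂ (L , 1≤L , m≤n⇒m≤1+n L≤m , c)
  fiberWalk (inj₂ e QW.∷ w) with project w
  ... | m′ , m′≤m , w′ = inj₂ (suc m′ , s≤s z≤n , s≤s m′≤m , e TW.∷ w′)

  kingLift : ∀ {i} (j : Fin (n i)) → IsKing (Arc Tg) k i
           → IsKing (Arc (H i)) k j ⊎ Cycle≤k i → IsKing (CompArc Tg H) k (i , j)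
  kingLift {i} j kingT _ (p , q) _ with p ≟ i
  kingLift {i} j kingT _ (p , q) _ | no p≢i with kingT p p≢i
  ... | ℓ , ℓ≤k , P = QW.walk⇒reach _≟Q_ (liftT w (TW.walk-nonempty w (λ i≡p → p≢i (sym i≡p))) j q) ℓ≤k
    where w = TW.path⇒walk P
  kingLift {i} j _ (inj₁ kingH) (.i , q) ij≢iq | yes refl with kingH q (λ { refl → ij≢iq refl })
  ... | ℓ , ℓ≤k , P = QW.walk⇒reach _≟Q_ (liftH (HW.path⇒walk i P)) ℓ≤k
  kingLift {i} j _ (inj₂ cyc) (.i , q) _ | yes refl with TW.cycle⇒closed cyc
  ... | L , 1≤L , L≤k , c = QW.walk⇒reach _≟Q_ (liftT c 1≤L j q) L≤k

  -- Necessity: the converse, where failure of u_{i,j} to be a king of Hᵢ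
  -- means some vertex of fibre i (so |V(Hᵢ)| ≥ 2) is only reached via T.
  kingProj : ∀ {i j} → IsKing (CompArc Tg H) k (i , j)
           → IsKing (Arc Tg) k i × (IsKing (Arc (H i)) k j ⊎ (2 ≤ n i × Cycle≤k i))
  kingProj {i} {j} kingQ = kingT , finChoice reachInFibre
    where
    kingT : IsKing (Arc Tg) k i
    kingT y y≢i with kingQ (y , point y) (λ { refl → y≢i refl })
    ... | ℓ , ℓ≤k , P with project (QW.path⇒walk P)
    ...   | m , m≤ℓ , w = TW.walk⇒reach _≟_ w (≤-trans m≤ℓ ℓ≤k)

    reachInFibre : ∀ q → (q ≢ j → Reach (Arc (H i)) k j q) ⊎ (2 ≤ n i × Cycle≤k i)
    reachInFibre q with q ≟ j
    ... | yes q≡j = inj₁ λ q≢j → ⊥-elim (q≢j q≡j)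
    ... | no q≢j with kingQ (i , q) (λ { refl → q≢j refl })
    ...   | ℓ , ℓ≤k , P with fiberWalk (QW.path⇒walk P)
    ...     | inj₁ (m , m≤ℓ , h) = inj₁ λ _ → HW.walk⇒reach i _≟_ h (≤-trans m≤ℓ ℓ≤k)
    ...     | inj₂ (L , 1≤L , L≤ℓ , c) =
      inj₂ (distinct⇒2≤ q j q≢j , TW.closed⇒cycle _≟_ (arc-irreflexive Tg) c 1≤L (≤-trans L≤ℓ ℓ≤k))

theorem2p4 : (k t : ℕ) (n : Fin t → ℕ) (Tg : Digraph t) (H : (i : Fin t) → Digraph (n i))
    → 2 ≤ k → 2 ≤ t → (∀ i → 1 ≤ n i)
    → (HasKing (CompArc Tg H) k
        ⇔ (∃[ i ] (IsKing (Arc Tg) k i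
              × (HasKing (Arc (H i)) k ⊎ (2 ≤ n i × OnCycleAtMost (Arc Tg) k i)))))
    × (AllKings (CompArc Tg H) k
        ⇔ (∀ i → IsKing (Arc Tg) k i
              × (AllKings (Arc (H i)) k ⊎ (2 ≤ n i × OnCycleAtMost (Arc Tg) k i))))
theorem2p4 k t n Tg H _ _ nonempty = mk⇔ hasKing⇒ hasKing⇐ , mk⇔ allKings⇒ allKings⇐
  where
  open Composition Tg H nonempty k

  hasKing⇒ : HasKing (CompArc Tg H) k
           → ∃[ i ] IsKing (Arc Tg) k i × (HasKing (Arc (H i)) k ⊎ (2 ≤ n i × Cycle≤k i))
  hasKing⇒ ((i , j) , king) = i , map₂ (map₁ (j ,_)) (kingProj king)

  hasKing⇐ : ∃[ i ] IsKing (Arc Tg) k i × (HasKing (Arc (H i)) k ⊎ (2 ≤ n i × Cycle≤k i))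
           → HasKing (CompArc Tg H) k
  hasKing⇐ (i , kingT , inj₁ (j , kingH)) = (i , j) , kingLift j kingT (inj₁ kingH)
  hasKing⇐ (i , kingT , inj₂ (_ , cyc))   = (i , point i) , kingLift (point i) kingT (inj₂ cyc)

  allKings⇒ : AllKings (CompArc Tg H) k
            → ∀ i → IsKing (Arc Tg) k i × (AllKings (Arc (H i)) k ⊎ (2 ≤ n i × Cycle≤k i))
  allKings⇒ all i = proj₁ (kingProj (all (i , point i))) , finChoice (λ j → proj₂ (kingProj (all (i , j))))

  allKings⇐ : (∀ i → IsKing (Arc Tg) k i × (AllKings (Arc (H i)) k ⊎ (2 ≤ n i × Cycle≤k i)))
            → AllKings (CompArc Tg H) k
  allKings⇐ cond (i , j) = kingLift j (proj₁ (cond i)) (map⊎ (λ allH → allH j) proj₂ (proj₂ (cond i)))
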